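{- Let $M=(E,\mathcal{I})$ be a unique expansion matroid on a finite set $E$ with $r(M)>0$, and write $F(M)=\{K_1,\dots,K_t\}$ with the $K_i$ distinct. Then $\mathcal{B}(M)=\{\{b_1,\dots,b_t\}: b_i\in K_i,\ 1\le i\le t\}$.
   Context: $\mathcal{B}(M)$ is the family of bases, $r(M)$ the common cardinality of bases, $r(X)$ the rank of $X\subseteq E$. $s(M)=\{A\in\mathcal{I}: |A|=r(M)-1\}$. For $X\subseteq E$, $K_M(X)=\{a\in E: r(X\cup\{a\})=r(X)+1\}$; $F(M)=\{K_M(X): X\in s(M)\}$. $M$ is a unique expansion matroid if for every $B\in\mathcal{B}(M)$ and every $A\in s(M)$, whenever $e_1,e_2\in B$ satisfy $A\cup\{e_1\},A\cup\{e_2\}\in\mathcal{B}(M)$, then $e_1=e_2$. -}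

module Defs where

open import Data.Nat using (ℕ; suc; _<_; _≤_; _∸_)
open import Data.Fin using (Fin)
open import Data.Fin.Subset using (Subset; _∈_; _∉_; _⊆_; _∪_; ⁅_⁆; ∣_∣; ⊥; ⊤)
open import Data.Product using (Σ; ∃; _×_)
open import Relation.Binary.PropositionalEquality using (_≡_)

record Matroid (n : ℕ) : Set₁ where
  field
    Indep        : Subset n → Set
    indep-empty  : Indep ⊥
    indep-hered  : ∀ {I J} → Indep J → I ⊆ J → Indep I
    indep-augment : ∀ {I J} → Indep I → Indep J → ∣ I ∣ < ∣ J ∣ →
                    ∃ λ e → e ∈ J × e ∉ I × Indep (⁅ e ⁆ ∪ I)

module _ {n : ℕ} (M : Matroid n) where
  open Matroid M

  IsBasis : Subset n → Set
  IsBasis B = Indep B × (∀ Y → Indep Y → B ⊆ Y → Y ⊆ B)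

  IsRank : Subset n → ℕ → Set
  IsRank X k = (Σ (Subset n) λ I → I ⊆ X × Indep I × ∣ I ∣ ≡ k)
             × (∀ I → I ⊆ X → Indep I → ∣ I ∣ ≤ k)

  IsRankM : ℕ → Set
  IsRankM k = IsRank ⊤ k

  InS : Subset n → Set
  InS A = Indep A × (∀ k → IsRankM k → ∣ A ∣ ≡ k ∸ 1)

  InK : Subset n → Fin n → Set
  InK X a = Σ ℕ λ k → IsRank X k × IsRank (X ∪ ⁅ a ⁆) (suc k)

  InF : Subset n → Set
  InF K = Σ (Subset n) λ X → InS X × (∀ a → (a ∈ K → InK X a) × (InK X a → a ∈ K))

  UniqueExpansion : Set
  UniqueExpansion = ∀ B A e₁ e₂ → IsBasis B → InS A → e₁ ∈ B → e₂ ∈ B →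
    IsBasis (A ∪ ⁅ e₁ ⁆) → IsBasis (A ∪ ⁅ e₂ ⁆) → e₁ ≡ e₂

-- Fix X_j ∈ s(M) with K_j = K_M(X_j). Every basis B meets every K_j, since X_j can be
-- augmented from B, and by unique expansion it meets K_j only once, since X_j ∪ {e} is a
-- basis for every e ∈ K_j. Every element x of B lies in some K_j, namely in
-- K_M(B - x) ∈ F(M). Two classes K_i, K_j sharing an element coincide, so the classes
-- are disjoint and B picks exactly one element of each. Conversely, in a basis the
-- representative of K_j may be exchanged for any other element of K_j (augment B minus it
-- from X_j ∪ {c}: the new element cannot lie in X_j), and doing this for every j turns a
-- basis into any given transversal.
--
-- Independence is not decidable, so bases exist only up to double negation; this suffices
-- wherever the goal is decidable, and a genuine first basis X_j ∪ {b_j} comes from the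
-- transversal itself.
module Submission where

open import Defs
open import Data.Nat using (ℕ; zero; suc; _<_; _≤_; _∸_; _+_; s≤s)
open import Data.Nat.Properties
  using (≤-antisym; ≤-trans; ≤-reflexive; <⇒≱; ≮⇒≥; m≤m+n; +-suc; +-monoʳ-≤; m+[n∸m]≡n)
open import Data.Fin using (Fin; zero; suc; _≟_)
open import Data.Fin.Properties using (any?)
open import Data.Fin.Subset
open import Data.Fin.Subset.Properties
open import Data.Vec using ([]; _∷_; here; there)
open import Data.Vec.Functional using (updateAt)
open import Data.Vec.Functional.Properties using (updateAt-updates; updateAt-minimal)
open import Data.List using ([]; _∷_; allFin)
open import Data.List.Relation.Unary.Any using (tail)
open import Data.List.Membership.Propositional using () renaming (_∈_ to _∈ₗ_)
open import Data.List.Membership.Propositional.Properties using (∈-allFin)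
open import Data.Product using (Σ; ∃; _×_; _,_; proj₁; proj₂)
open import Data.Sum using (_⊎_; inj₁; inj₂)
open import Data.Empty using (⊥-elim)
open import Function using (_∘_; const)
open import Relation.Nullary using (¬_; Dec; yes; no)
open import Relation.Nullary.Decidable using (decidable-stable; ¬¬-excluded-middle)
open import Relation.Binary.PropositionalEquality

private variable
  n t : ℕ
  x y : Fin n
  p q : Subset n

x∈⁅x⁆∪p : (x : Fin n) (p : Subset n) → x ∈ ⁅ x ⁆ ∪ p
x∈⁅x⁆∪p x p = x∈p∪q⁺ (inj₁ (x∈⁅x⁆ x))

x∈p⇒⁅x⁆∪p⊆q : x ∈ q → p ⊆ q → ⁅ x ⁆ ∪ p ⊆ q
x∈p⇒⁅x⁆∪p⊆q {x = x} {p = p} x∈q p⊆q y∈ with x∈p∪q⁻ ⁅ x ⁆ p y∈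
... | inj₁ y∈⁅x⁆ = subst (_∈ _) (sym (x∈⁅y⁆⇒x≡y x y∈⁅x⁆)) x∈q
... | inj₂ y∈p   = p⊆q y∈p

x∈p∪⁅y⁆∧x∉p⇒x≡y : x ∈ p ∪ ⁅ y ⁆ → x ∉ p → x ≡ y
x∈p∪⁅y⁆∧x∉p⇒x≡y {p = p} {y = y} x∈ x∉p with x∈p∪q⁻ p ⁅ y ⁆ x∈
... | inj₁ x∈p   = ⊥-elim (x∉p x∈p)
... | inj₂ x∈⁅y⁆ = x∈⁅y⁆⇒x≡y y x∈⁅y⁆

y∈p⇒p∪⁅y⁆⊆p : y ∈ p → p ∪ ⁅ y ⁆ ⊆ p
y∈p⇒p∪⁅y⁆⊆p {p = p} y∈p {x} x∈ with x ∈? p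
... | yes x∈p = x∈p
... | no x∉p  = subst (_∈ p) (sym (x∈p∪⁅y⁆∧x∉p⇒x≡y x∈ x∉p)) y∈p

x∉p⇒∣p∣<∣⁅x⁆∪p∣ : x ∉ p → ∣ p ∣ < ∣ ⁅ x ⁆ ∪ p ∣
x∉p⇒∣p∣<∣⁅x⁆∪p∣ {x = x} {p = p} x∉p =
  p⊂q⇒∣p∣<∣q∣ (q⊆p∪q ⁅ x ⁆ p , x , x∈⁅x⁆∪p x p , x∉p)

∣⁅x⁆∪p∣≤1+∣p∣ : (x : Fin n) (p : Subset n) → ∣ ⁅ x ⁆ ∪ p ∣ ≤ suc ∣ p ∣
∣⁅x⁆∪p∣≤1+∣p∣ zero    (s ∷ p) rewrite ∪-identityˡ p = s≤s (∣p∣≤∣x∷p∣ s p)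
∣⁅x⁆∪p∣≤1+∣p∣ (suc x) (inside ∷ p)  = s≤s (∣⁅x⁆∪p∣≤1+∣p∣ x p)
∣⁅x⁆∪p∣≤1+∣p∣ (suc x) (outside ∷ p) = ∣⁅x⁆∪p∣≤1+∣p∣ x p

x∉p⇒∣⁅x⁆∪p∣≡1+∣p∣ : x ∉ p → ∣ ⁅ x ⁆ ∪ p ∣ ≡ suc ∣ p ∣
x∉p⇒∣⁅x⁆∪p∣≡1+∣p∣ {x = x} {p = p} x∉p = ≤-antisym (∣⁅x⁆∪p∣≤1+∣p∣ x p) (x∉p⇒∣p∣<∣⁅x⁆∪p∣ x∉p)

p⊆q∧∣q∣≤∣p∣⇒q⊆p : p ⊆ q → ∣ q ∣ ≤ ∣ p ∣ → q ⊆ p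
p⊆q∧∣q∣≤∣p∣⇒q⊆p {p = p} p⊆q ∣q∣≤∣p∣ {x} x∈q with x ∈? p
... | yes x∈p = x∈p
... | no x∉p  = ⊥-elim (<⇒≱ (p⊂q⇒∣p∣<∣q∣ (p⊆q , x , x∈q , x∉p)) ∣q∣≤∣p∣)

x∈p─q⇒x∉q : (p q : Subset n) → x ∈ p ─ q → x ∉ q
x∈p─q⇒x∉q (_ ∷ p) (inside ∷ q)  (there x∈) (there x∈q) = x∈p─q⇒x∉q p q x∈ x∈q
x∈p─q⇒x∉q (_ ∷ p) (outside ∷ q) (there x∈) (there x∈q) = x∈p─q⇒x∉q p q x∈ x∈q

x∈p-y⇒x≢y : (p : Subset n) → x ∈ p - y → x ≢ y
x∈p-y⇒x≢y {y = y} p x∈ = x∉⁅y⁆⇒x≢y (x∈p─q⇒x∉q p ⁅ y ⁆ x∈)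

x∉p-x : (x : Fin n) (p : Subset n) → x ∉ p - x
x∉p-x x p x∈ = x∈p-y⇒x≢y p x∈ refl

x∈p⇒∣p∣≡1+∣p-x∣ : x ∈ p → ∣ p ∣ ≡ suc ∣ p - x ∣
x∈p⇒∣p∣≡1+∣p-x∣ {x = x} {p = p} x∈p =
  ≤-antisym (≤-trans (p⊆q⇒∣p∣≤∣q∣ p⊆⁅x⁆∪p-x) (∣⁅x⁆∪p∣≤1+∣p∣ x (p - x))) (x∈p⇒∣p-x∣<∣p∣ x∈p)
  where
  p⊆⁅x⁆∪p-x : p ⊆ ⁅ x ⁆ ∪ (p - x)
  p⊆⁅x⁆∪p-x {y} y∈p with y ≟ x
  ... | yes refl = x∈⁅x⁆∪p x (p - x)
  ... | no y≢x   = q⊆p∪q ⁅ x ⁆ (p - x) (x∈p∧x≢y⇒x∈p-y y∈p y≢x)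

0<∣p∣⇒Nonempty : 0 < ∣ p ∣ → Nonempty p
0<∣p∣⇒Nonempty {n} {p} 0<∣p∣ = decidable-stable (nonempty? p) λ p-empty →
  <⇒≱ 0<∣p∣ (≤-reflexive (trans (cong ∣_∣ (Empty-unique p-empty)) (∣⊥∣≡0 n)))

Fin-stable : ¬ ¬ Fin t → Fin t
Fin-stable {zero}  ¬¬i = ⊥-elim (¬¬i λ ())
Fin-stable {suc t} _   = zero

¬¬-tabulate : (P : Fin n → Set) → ¬ ¬ (∃ λ L → ∀ a → (a ∈ L → P a) × (P a → a ∈ L))
¬¬-tabulate {zero}  P ¬L = ¬L ([] , λ ())
¬¬-tabulate {suc n} P ¬L = ¬¬-excluded-middle λ P0? →
  ¬¬-tabulate (P ∘ suc) λ (L , L↔P∘suc) → ¬L (cons P0? L L↔P∘suc)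
  where
  cons : Dec (P zero) → (L : Subset n) → (∀ a → (a ∈ L → P (suc a)) × (P (suc a) → a ∈ L)) →
         ∃ λ L′ → ∀ a → (a ∈ L′ → P a) × (P a → a ∈ L′)
  cons (yes P0) L L↔ = inside ∷ L , λ where
    zero    → (λ _ → P0) , (λ _ → here)
    (suc a) → (λ { (there a∈L) → proj₁ (L↔ a) a∈L }) , there ∘ proj₂ (L↔ a)
  cons (no ¬P0) L L↔ = outside ∷ L , λ where
    zero    → (λ ()) , (⊥-elim ∘ ¬P0)
    (suc a) → (λ { (there a∈L) → proj₁ (L↔ a) a∈L }) , there ∘ proj₂ (L↔ a)

_enumerates_ : (Fin t → Fin n) → Subset n → Set
g enumerates S = ∀ x → (x ∈ S → ∃ λ i → g i ≡ x) × ((∃ λ i → g i ≡ x) → x ∈ S)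

pointwise-equal⇒image⊆ : ∀ {f g : Fin t → Fin n} {S T} →
  f enumerates S → g enumerates T → (∀ i → f i ≡ g i) → S ⊆ T
pointwise-equal⇒image⊆ f↠S g↠T f≗g {x} x∈S with proj₁ (f↠S x) x∈S
... | i , fi≡x = proj₂ (g↠T x) (i , trans (sym (f≗g i)) fi≡x)

pointwise-equal⇒same-image : ∀ {f g : Fin t → Fin n} {S T} →
  f enumerates S → g enumerates T → (∀ i → f i ≡ g i) → S ≡ T
pointwise-equal⇒same-image f↠S g↠T f≗g =
  ⊆-antisym (pointwise-equal⇒image⊆ f↠S g↠T f≗g) (pointwise-equal⇒image⊆ g↠T f↠S (sym ∘ f≗g))

updateAt-enumerates : ∀ {g : Fin t → Fin n} {S} {j c} → g enumerates S →
  (∀ {i} → g i ≡ g j → i ≡ j) → updateAt g j (const c) enumerates (⁅ c ⁆ ∪ (S - g j))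
updateAt-enumerates {t = t} {n = n} {g = g} {S} {j} {c} g↠S g-injective-at-j x = covered , contained
  where
  g′ : Fin t → Fin n
  g′ = updateAt g j (const c)

  covered : x ∈ ⁅ c ⁆ ∪ (S - g j) → ∃ λ i → g′ i ≡ x
  covered x∈ with x∈p∪q⁻ ⁅ c ⁆ (S - g j) x∈
  ... | inj₁ x∈⁅c⁆ = j , trans (updateAt-updates j g) (sym (x∈⁅y⁆⇒x≡y c x∈⁅c⁆))
  ... | inj₂ x∈S-gj with proj₁ (g↠S x) (p─q⊆p S ⁅ g j ⁆ x∈S-gj)
  ...   | i , gi≡x with i ≟ j
  ...     | yes refl = ⊥-elim (x∈p-y⇒x≢y S x∈S-gj (sym gi≡x))
  ...     | no i≢j   = i , trans (updateAt-minimal i j g i≢j) gi≡x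

  contained : (∃ λ i → g′ i ≡ x) → x ∈ ⁅ c ⁆ ∪ (S - g j)
  contained (i , refl) with i ≟ j
  ... | yes refl = subst (_∈ _) (sym (updateAt-updates j g)) (x∈⁅x⁆∪p c (S - g j))
  ... | no i≢j   = subst (_∈ _) (sym (updateAt-minimal i j g i≢j))
    (q⊆p∪q ⁅ c ⁆ (S - g j) (x∈p∧x≢y⇒x∈p-y (proj₂ (g↠S (g i)) (i , refl)) (i≢j ∘ g-injective-at-j)))

module MatroidProperties {n : ℕ} (M : Matroid n) where
  open Matroid M

  private variable
    A B B′ I Y : Subset n
    a : Fin n

  indep⇒rank : Indep Y → IsRank M Y ∣ Y ∣
  indep⇒rank iY = (_ , ⊆-refl , iY , refl) , λ _ I⊆Y _ → p⊆q⇒∣p∣≤∣q∣ I⊆Y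

  rank-of-indep : ∀ {k} → Indep Y → IsRank M Y k → k ≡ ∣ Y ∣
  rank-of-indep {Y} iY ((I , I⊆Y , _ , ∣I∣≡k) , maximum) =
    ≤-antisym (subst (_≤ ∣ Y ∣) ∣I∣≡k (p⊆q⇒∣p∣≤∣q∣ I⊆Y)) (maximum Y ⊆-refl iY)

  extension⇒InK : Indep Y → a ∉ Y → Indep (⁅ a ⁆ ∪ Y) → InK M Y a
  extension⇒InK {Y} {a} iY a∉Y iaY =
    ∣ Y ∣ , indep⇒rank iY ,
    subst (IsRank M (Y ∪ ⁅ a ⁆)) (trans (cong ∣_∣ (∪-comm Y ⁅ a ⁆)) (x∉p⇒∣⁅x⁆∪p∣≡1+∣p∣ a∉Y))
      (indep⇒rank (subst Indep (∪-comm ⁅ a ⁆ Y) iaY))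

  InK⇒extension : Indep Y → InK M Y a → a ∉ Y × Indep (⁅ a ⁆ ∪ Y)
  InK⇒extension {Y} {a} iY (k , rankY , (W , W⊆Y∪a , iW , ∣W∣≡1+k) , _) = a∉Y , iaY
    where
    ∣Y∣<∣W∣ : ∣ Y ∣ < ∣ W ∣
    ∣Y∣<∣W∣ = ≤-reflexive (sym (trans ∣W∣≡1+k (cong suc (rank-of-indep iY rankY))))

    a∉Y : a ∉ Y
    a∉Y a∈Y = <⇒≱ ∣Y∣<∣W∣ (p⊆q⇒∣p∣≤∣q∣ (y∈p⇒p∪⁅y⁆⊆p a∈Y ∘ W⊆Y∪a))

    iaY : Indep (⁅ a ⁆ ∪ Y)
    iaY with indep-augment iY iW ∣Y∣<∣W∣
    ... | e , e∈W , e∉Y , ieY = subst (λ z → Indep (⁅ z ⁆ ∪ Y)) (x∈p∪⁅y⁆∧x∉p⇒x≡y (W⊆Y∪a e∈W) e∉Y) ieY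

  indep-size≤basis-size : IsBasis M B → Indep I → ∣ I ∣ ≤ ∣ B ∣
  indep-size≤basis-size {B} (iB , maximal) iI = ≮⇒≥ λ ∣B∣<∣I∣ →
    let e , _ , e∉B , ieB = indep-augment iB iI ∣B∣<∣I∣
    in  e∉B (maximal (⁅ e ⁆ ∪ B) ieB (q⊆p∪q ⁅ e ⁆ B) (x∈⁅x⁆∪p e B))

  basis-size-unique : IsBasis M B → IsBasis M B′ → ∣ B′ ∣ ≡ ∣ B ∣
  basis-size-unique bB bB′ = ≤-antisym (indep-size≤basis-size bB (proj₁ bB′)) (indep-size≤basis-size bB′ (proj₁ bB))

  basis⇒rank : IsBasis M B → IsRankM M ∣ B ∣
  basis⇒rank bB = (_ , ⊆⊤ , proj₁ bB , refl) , λ _ _ iI → indep-size≤basis-size bB iI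

  rank≡basis-size : ∀ {k} → IsBasis M B → IsRankM M k → k ≡ ∣ B ∣
  rank≡basis-size {B} bB ((I , _ , iI , ∣I∣≡k) , maximum) =
    ≤-antisym (subst (_≤ ∣ B ∣) ∣I∣≡k (indep-size≤basis-size bB iI)) (maximum B ⊆⊤ (proj₁ bB))

  large-indep⇒basis : IsBasis M B → Indep I → ∣ B ∣ ≤ ∣ I ∣ → IsBasis M I
  large-indep⇒basis bB iI ∣B∣≤∣I∣ =
    iI , λ Y iY I⊆Y → p⊆q∧∣q∣≤∣p∣⇒q⊆p I⊆Y (≤-trans (indep-size≤basis-size bB iY) ∣B∣≤∣I∣)

  InS-size : IsBasis M B → 0 < ∣ B ∣ → InS M A → ∣ B ∣ ≡ suc ∣ A ∣
  InS-size {B} bB 0<∣B∣ (_ , ∣A∣≡r-1) =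
    trans (sym (m+[n∸m]≡n 0<∣B∣)) (cong suc (sym (∣A∣≡r-1 ∣ B ∣ (basis⇒rank bB))))

  basis-remove⇒InS : IsBasis M B → a ∈ B → InS M (B - a)
  basis-remove⇒InS {B} bB a∈B = indep-hered (proj₁ bB) (p─q⊆p B ⁅ _ ⁆) , λ k rank≡k →
    cong (_∸ 1) (trans (sym (x∈p⇒∣p∣≡1+∣p-x∣ a∈B)) (sym (rank≡basis-size bB rank≡k)))

  basis-remove⇒InK : IsBasis M B → a ∈ B → InK M (B - a) a
  basis-remove⇒InK {B} {a} bB a∈B = extension⇒InK (indep-hered (proj₁ bB) (p─q⊆p B ⁅ a ⁆)) (x∉p-x a B)
    (indep-hered (proj₁ bB) (x∈p⇒⁅x⁆∪p⊆q a∈B (p─q⊆p B ⁅ a ⁆)))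

  InS-augment : IsBasis M B → 0 < ∣ B ∣ → InS M A → ∃ λ e → e ∈ B × InK M A e
  InS-augment {B} {A} bB 0<∣B∣ sA with indep-augment (proj₁ sA) (proj₁ bB) (≤-reflexive (sym (InS-size bB 0<∣B∣ sA)))
  ... | e , e∈B , e∉A , ieA = e , e∈B , extension⇒InK (proj₁ sA) e∉A ieA

  maximal-or-extensible : Indep I → ¬ ¬ (IsBasis M I ⊎ ∃ λ e → e ∉ I × Indep (⁅ e ⁆ ∪ I))
  maximal-or-extensible {I} iI ¬answer = ¬¬-excluded-middle λ where
    (yes extensible) → ¬answer (inj₂ extensible)
    (no ¬extensible) → ¬answer (inj₁ (iI , λ Y iY I⊆Y {y} y∈Y → decidable-stable (y ∈? I) λ y∉I →
      ¬extensible (y , y∉I , indep-hered iY (x∈p⇒⁅x⁆∪p⊆q y∈Y I⊆Y))))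

  ¬¬-basis-above : ∀ k {I} → Indep I → n ≤ k + ∣ I ∣ → ¬ ¬ ∃ (IsBasis M)
  ¬¬-basis-above zero {I} iI n≤∣I∣ ¬basis = maximal-or-extensible iI λ where
    (inj₁ bI)              → ¬basis (I , bI)
    (inj₂ (e , e∉I , _))   → <⇒≱ (x∉p⇒∣p∣<∣⁅x⁆∪p∣ e∉I) (≤-trans (∣p∣≤n (⁅ e ⁆ ∪ I)) n≤∣I∣)
  ¬¬-basis-above (suc k) {I} iI n≤1+k+∣I∣ ¬basis = maximal-or-extensible iI λ where
    (inj₁ bI)              → ¬basis (I , bI)
    (inj₂ (e , e∉I , ieI)) → ¬¬-basis-above k ieI
      (≤-trans n≤1+k+∣I∣ (subst (_≤ k + ∣ ⁅ e ⁆ ∪ I ∣) (+-suc k ∣ I ∣) (+-monoʳ-≤ k (x∉p⇒∣p∣<∣⁅x⁆∪p∣ e∉I))))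
      ¬basis

  ¬¬-basis : ¬ ¬ ∃ (IsBasis M)
  ¬¬-basis = ¬¬-basis-above n indep-empty (m≤m+n n ∣ ⊥ {n = n} ∣)

  InS∪InK⇒basis : (∀ r → IsRankM M r → 0 < r) → InS M A → InK M A a → IsBasis M (A ∪ ⁅ a ⁆)
  InS∪InK⇒basis {A} {a} rank-positive sA a∈K = subst (IsBasis M) (∪-comm ⁅ a ⁆ A) (iaA , maximal)
    where
    a∉A : a ∉ A
    a∉A = proj₁ (InK⇒extension (proj₁ sA) a∈K)

    iaA : Indep (⁅ a ⁆ ∪ A)
    iaA = proj₂ (InK⇒extension (proj₁ sA) a∈K)

    maximal : ∀ Y → Indep Y → ⁅ a ⁆ ∪ A ⊆ Y → Y ⊆ ⁅ a ⁆ ∪ A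
    maximal Y iY aA⊆Y = decidable-stable (Y ⊆? (⁅ a ⁆ ∪ A)) λ Y⊈aA → ¬¬-basis λ (B , bB) →
      let ∣B∣≡∣aA∣ = trans (InS-size bB (rank-positive _ (basis⇒rank bB)) sA) (sym (x∉p⇒∣⁅x⁆∪p∣≡1+∣p∣ a∉A))
      in  Y⊈aA (proj₂ (large-indep⇒basis bB iaA (≤-reflexive ∣B∣≡∣aA∣)) Y iY aA⊆Y)

module UniqueExpansionMatroid {n : ℕ} (M : Matroid n) (unique-expansion : UniqueExpansion M)
  (rank-positive : ∀ r → IsRankM M r → 0 < r)
  {t : ℕ} (K : Fin t → Subset n) (K-injective : ∀ i j → K i ≡ K j → i ≡ j)
  (K∈F : ∀ i → InF M (K i)) (F⊆K : ∀ L → InF M L → ∃ λ i → K i ≡ L) where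
  open Matroid M
  open MatroidProperties M

  private variable
    B S : Subset n
    a c d : Fin n
    i j : Fin t
    g : Fin t → Fin n

  X : Fin t → Subset n
  X j = proj₁ (K∈F j)

  X∈s : ∀ j → InS M (X j)
  X∈s j = proj₁ (proj₂ (K∈F j))

  K⇒InK : a ∈ K j → InK M (X j) a
  K⇒InK {a} {j} = proj₁ (proj₂ (proj₂ (K∈F j)) a)

  InK⇒K : InK M (X j) a → a ∈ K j
  InK⇒K {j} {a} = proj₂ (proj₂ (proj₂ (K∈F j)) a)

  K⇒∉X : a ∈ K j → a ∉ X j
  K⇒∉X {j = j} a∈Kj = proj₁ (InK⇒extension (proj₁ (X∈s j)) (K⇒InK a∈Kj))

  X∪K-basis : a ∈ K j → IsBasis M (X j ∪ ⁅ a ⁆)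
  X∪K-basis {j = j} a∈Kj = InS∪InK⇒basis rank-positive (X∈s j) (K⇒InK a∈Kj)

  basis-nonempty : IsBasis M B → 0 < ∣ B ∣
  basis-nonempty bB = rank-positive _ (basis⇒rank bB)

  basis-meets-K : IsBasis M B → ∀ j → ∃ λ d → d ∈ B × d ∈ K j
  basis-meets-K bB j with InS-augment bB (basis-nonempty bB) (X∈s j)
  ... | d , d∈B , d∈K[Xj] = d , d∈B , InK⇒K d∈K[Xj]

  basis-meets-K-once : IsBasis M B → c ∈ B → d ∈ B → c ∈ K j → d ∈ K j → c ≡ d
  basis-meets-K-once {j = j} bB c∈B d∈B c∈Kj d∈Kj =
    unique-expansion _ (X j) _ _ bB (X∈s j) c∈B d∈B (X∪K-basis c∈Kj) (X∪K-basis d∈Kj)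

  K-overlap⇒⊆ : a ∈ K i → a ∈ K j → K i ⊆ K j
  K-overlap⇒⊆ {a} {i} {j} a∈Ki a∈Kj {c} c∈Ki = meets-Kj-in-c (basis-meets-K (X∪K-basis c∈Ki) j)
    where
    meets-Kj-in-c : (∃ λ d → d ∈ X i ∪ ⁅ c ⁆ × d ∈ K j) → c ∈ K j
    meets-Kj-in-c (d , d∈Xi∪c , d∈Kj) with d ∈? X i
    ... | no d∉Xi  = subst (_∈ K j) (x∈p∪⁅y⁆∧x∉p⇒x≡y d∈Xi∪c d∉Xi) d∈Kj
    ... | yes d∈Xi = ⊥-elim (K⇒∉X a∈Ki (subst (_∈ X i) d≡a d∈Xi))
      where
      d≡a : d ≡ a
      d≡a = basis-meets-K-once (X∪K-basis a∈Ki) (p⊆p∪q ⁅ a ⁆ d∈Xi) (q⊆p∪q (X i) ⁅ a ⁆ (x∈⁅x⁆ a)) d∈Kj a∈Kj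

  K-disjoint : a ∈ K i → a ∈ K j → i ≡ j
  K-disjoint {i = i} {j = j} a∈Ki a∈Kj =
    K-injective i j (⊆-antisym (K-overlap⇒⊆ a∈Ki a∈Kj) (K-overlap⇒⊆ a∈Kj a∈Ki))

  basis⊆⋃K : IsBasis M B → a ∈ B → ∃ λ j → a ∈ K j
  basis⊆⋃K {B} {a} bB a∈B = decidable-stable (any? λ j → a ∈? K j) λ a∉⋃K →
    ¬¬-tabulate (InK M (B - a)) λ (L , L↔K[B-a]) →
      let j , Kj≡L = F⊆K L (B - a , basis-remove⇒InS bB a∈B , L↔K[B-a])
      in  a∉⋃K (j , subst (a ∈_) (sym Kj≡L) (proj₂ (L↔K[B-a] a) (basis-remove⇒InK bB a∈B)))

  IsTransversal : (Fin t → Fin n) → Set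
  IsTransversal g = ∀ i → g i ∈ K i

  transversal-injective : IsTransversal g → g i ≡ g j → i ≡ j
  transversal-injective {g} {i} {j} g∈K gi≡gj = K-disjoint (g∈K i) (subst (_∈ K j) (sym gi≡gj) (g∈K j))

  updateAt-transversal : IsTransversal g → c ∈ K j → IsTransversal (updateAt g j (const c))
  updateAt-transversal {g} {j = j} g∈K c∈Kj i with i ≟ j
  ... | yes refl = subst (_∈ K i) (sym (updateAt-updates i g)) c∈Kj
  ... | no i≢j   = subst (_∈ K i) (sym (updateAt-minimal i j g i≢j)) (g∈K i)

  basis⇒transversal : IsBasis M B → ∃ λ g → IsTransversal g × g enumerates B
  basis⇒transversal {B} bB = pick , pick∈K , λ x → covered x , λ { (i , refl) → proj₁ (proj₂ (basis-meets-K bB i)) }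
    where
    pick : Fin t → Fin n
    pick j = proj₁ (basis-meets-K bB j)

    pick∈K : IsTransversal pick
    pick∈K j = proj₂ (proj₂ (basis-meets-K bB j))

    covered : ∀ x → x ∈ B → ∃ λ j → pick j ≡ x
    covered x x∈B with basis⊆⋃K bB x∈B
    ... | j , x∈Kj = j , basis-meets-K-once bB (proj₁ (proj₂ (basis-meets-K bB j))) x∈B (pick∈K j) x∈Kj

  basis-exchange : IsBasis M S → d ∈ S → d ∈ K j → c ∈ K j → IsBasis M (⁅ c ⁆ ∪ (S - d))
  basis-exchange {S} {d} {j} {c} bS d∈S d∈Kj c∈Kj
    with indep-augment (indep-hered (proj₁ bS) (p─q⊆p S ⁅ d ⁆)) (proj₁ (X∪K-basis c∈Kj)) ∣S-d∣<∣Xj∪c∣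
    where
    ∣S-d∣<∣Xj∪c∣ : ∣ S - d ∣ < ∣ X j ∪ ⁅ c ⁆ ∣
    ∣S-d∣<∣Xj∪c∣ = ≤-reflexive (sym (trans (basis-size-unique bS (X∪K-basis c∈Kj)) (x∈p⇒∣p∣≡1+∣p-x∣ d∈S)))
  ... | e , e∈Xj∪c , e∉S-d , ieS-d = subst (λ z → IsBasis M (⁅ z ⁆ ∪ (S - d))) e≡c be
    where
    be : IsBasis M (⁅ e ⁆ ∪ (S - d))
    be = large-indep⇒basis bS ieS-d (≤-reflexive (trans (x∈p⇒∣p∣≡1+∣p-x∣ d∈S) (sym (x∉p⇒∣⁅x⁆∪p∣≡1+∣p∣ e∉S-d))))

    -- The new basis meets K j, but neither in e ∈ X j nor in S - d, whose only candidate was d.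
    e∉Xj : e ∉ X j
    e∉Xj e∈Xj with basis-meets-K be j
    ... | z , z∈ , z∈Kj with x∈p∪q⁻ ⁅ e ⁆ (S - d) z∈
    ...   | inj₁ z∈⁅e⁆ = K⇒∉X (subst (_∈ K j) (x∈⁅y⁆⇒x≡y e z∈⁅e⁆) z∈Kj) e∈Xj
    ...   | inj₂ z∈S-d = x∈p-y⇒x≢y S z∈S-d (basis-meets-K-once bS (p─q⊆p S ⁅ d ⁆ z∈S-d) d∈S z∈Kj d∈Kj)

    e≡c : e ≡ c
    e≡c = x∈p∪⁅y⁆∧x∉p⇒x≡y e∈Xj∪c e∉Xj

  EnumeratesBasis : (Fin t → Fin n) → Set
  EnumeratesBasis g = IsTransversal g × ∃ λ S → IsBasis M S × g enumerates S

  exchange : EnumeratesBasis g → c ∈ K j → EnumeratesBasis (updateAt g j (const c))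
  exchange {g} {j = j} (g∈K , S , bS , g↠S) c∈Kj =
    updateAt-transversal g∈K c∈Kj , _ ,
    basis-exchange bS (proj₂ (g↠S (g j)) (j , refl)) (g∈K j) c∈Kj ,
    updateAt-enumerates g↠S (transversal-injective g∈K)

  exchange-all : ∀ {b} → IsTransversal b → EnumeratesBasis g → ∀ L →
    ∃ λ h → EnumeratesBasis h × (∀ {i} → i ∈ₗ L → h i ≡ b i)
  exchange-all {g} _   eg []      = g , eg , λ ()
  exchange-all {b = b} b∈K eg (j ∷ L) with exchange-all b∈K eg L
  ... | h , eh , h≗b = updateAt h j (const (b j)) , exchange eh (b∈K j) , agrees
    where
    agrees : ∀ {i} → i ∈ₗ j ∷ L → updateAt h j (const (b j)) i ≡ b i
    agrees {i} i∈ with i ≟ j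
    ... | yes refl = updateAt-updates i h
    ... | no i≢j   = trans (updateAt-minimal i j h i≢j) (h≗b (tail i≢j i∈))

  some-index : Fin t
  some-index = Fin-stable λ no-index → ¬¬-basis λ (B , bB) →
    let x , x∈B = 0<∣p∣⇒Nonempty (basis-nonempty bB)
    in  no-index (proj₁ (basis⊆⋃K bB x∈B))

  transversal⇒basis : ∀ {b} → IsTransversal b → b enumerates B → IsBasis M B
  transversal⇒basis {B} {b} b∈K b↠B = agreeing⇒basis (exchange-all b∈K initial (allFin t))
    where
    initial-basis : IsBasis M (X some-index ∪ ⁅ b some-index ⁆)
    initial-basis = X∪K-basis (b∈K some-index)

    initial : EnumeratesBasis (proj₁ (basis⇒transversal initial-basis))
    initial = let _ , g∈K , g↠ = basis⇒transversal initial-basis in g∈K , _ , initial-basis , g↠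

    agreeing⇒basis : (∃ λ h → EnumeratesBasis h × (∀ {i} → i ∈ₗ allFin t → h i ≡ b i)) → IsBasis M B
    agreeing⇒basis (h , (_ , S , bS , h↠S) , h≗b) =
      subst (IsBasis M) (pointwise-equal⇒same-image h↠S b↠B λ i → h≗b (∈-allFin i)) bS

proposition8 : ∀ {n} (M : Matroid n) → UniqueExpansion M →
    (∀ r → IsRankM M r → 0 < r) →
    (t : ℕ) (K : Fin t → Subset n) →
    (∀ i j → K i ≡ K j → i ≡ j) →
    (∀ i → InF M (K i)) →
    (∀ L → InF M L → Σ (Fin t) λ i → K i ≡ L) →
    ∀ B → (IsBasis M B → Σ (Fin t → Fin n) λ b → (∀ i → b i ∈ K i) × (∀ x → (x ∈ B → Σ (Fin t) λ i → b i ≡ x) × ((Σ (Fin t) λ i → b i ≡ x) → x ∈ B)))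
        × ((Σ (Fin t → Fin n) λ b → (∀ i → b i ∈ K i) × (∀ x → (x ∈ B → Σ (Fin t) λ i → b i ≡ x) × ((Σ (Fin t) λ i → b i ≡ x) → x ∈ B))) → IsBasis M B)
proposition8 M unique-expansion rank-positive t K K-injective K∈F F⊆K B =
  basis⇒transversal , λ (b , b∈K , b↠B) → transversal⇒basis b∈K b↠B
  where open UniqueExpansionMatroid M unique-expansion rank-positive K K-injective K∈F F⊆K
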